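{- Let $C$ be a caterpillar with spine $u_1u_2\cdots u_s$ and code $(c_1,0,c_3,\dots,c_s)$, let $c\ge 1$, and let $T$ be the tree obtained from $C$ by adding a disjoint star $K_{1,c}$ and joining its center to $u_2$ by an edge. Then \[ PWW(T)=3\binom{c_1}{2}+3\binom{c_s}{2}+3\binom{c}{2}+10\,c_1c+\frac{c_s(c_1+c)}{2}(s+1)(s+2). \]
   Context: A caterpillar is a tree such that deleting all leaves (and their incident edges) yields a path, called its spine; write the spine as $u_1u_2\cdots u_s$ in path order. The code of the caterpillar is $(c_1,\dots,c_s)$ where $c_i$ is the number of leaves adjacent to $u_i$ (so $c_1\ne0$, $c_s\ne 0$). $K_{1,c}$ is the star with a center and $c$ leaves. $d(x,y)$ is the distance in the tree; the eccentricity of $v$ is $\max_x d(x,v)$; the diameter is the maximum eccentricity; a vertex is peripheral if its eccentricity equals the diameter; $\operatorname{Peri}$ is the set of peripheral vertices; $PWW(T)=\frac12\sum_{\{x,y\}\subseteq\operatorname{Peri}(T)}(d(x,y)+d(x,y)^2)$ over unordered pairs of distinct peripheral vertices. -}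

module Defs where

open import Data.Nat using (ℕ; zero; suc; _+_; _*_; _≤_; _⊔_; _≟_)
open import Data.Nat.DivMod using (_/_)
open import Data.Fin using (Fin; toℕ)
open import Data.Nat.ListAction using (sum)
open import Data.List using (List; []; _∷_; map; _++_; foldr; filter; concatMap; [_])
open import Data.List.Base using (allFin)
open import Data.Product using (_×_; _,_; proj₁; proj₂)
open import Relation.Binary.PropositionalEquality using (_≡_)

record Graph : Set₁ where
  field
    V     : Set
    verts : List V          -- every vertex exactly once
    _~_   : V → V → Set

open Graph public

data Walk (G : Graph) : V G → V G → ℕ → Set where
  nil  : ∀ {x} → Walk G x x 0
  step : ∀ {x y z k} → _~_ G x y → Walk G y z k → Walk G x z (suc k)

IsDistance : (G : Graph) → (V G → V G → ℕ) → Set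
IsDistance G d = ∀ x y → Walk G x y (d x y) × (∀ m → Walk G x y m → d x y ≤ m)

pairs : {A : Set} → List A → List (A × A)
pairs []       = []
pairs (x ∷ xs) = map (x ,_) xs ++ pairs xs

maxList : List ℕ → ℕ
maxList = foldr _⊔_ 0

module _ (G : Graph) (d : V G → V G → ℕ) where

  eccentricity : V G → ℕ
  eccentricity v = maxList (map (λ x → d x v) (verts G))

  diameter : ℕ
  diameter = maxList (map eccentricity (verts G))

  Peri : List (V G)
  Peri = filter (λ v → eccentricity v ≟ diameter) (verts G)

  PWW : ℕ
  PWW = sum (map (λ p → d (proj₁ p) (proj₂ p) + d (proj₁ p) (proj₂ p) * d (proj₁ p) (proj₂ p))
                 (pairs Peri)) / 2

-- The tree T: caterpillar with spine u_1 … u_s and code (code 1, …, code s)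
-- (1-based: code i = c_i), plus a star K_{1,c} whose center is joined to u_2.

module _ (s : ℕ) (code : ℕ → ℕ) (c : ℕ) where

  data TV : Set where
    spine  : Fin s → TV                                  -- spine i = u_{toℕ i + 1}
    leaf   : (i : Fin s) → Fin (code (suc (toℕ i))) → TV
    center : TV
    sleaf  : Fin c → TV

  data TAdj : TV → TV → Set where
    sp-next : ∀ {i j} → toℕ j ≡ suc (toℕ i) → TAdj (spine i) (spine j)
    sp-prev : ∀ {i j} → toℕ i ≡ suc (toℕ j) → TAdj (spine i) (spine j)
    sp-leaf : ∀ {i a} → TAdj (spine i) (leaf i a)
    leaf-sp : ∀ {i a} → TAdj (leaf i a) (spine i)
    sp-cen  : ∀ {i} → toℕ i ≡ 1 → TAdj (spine i) center  -- spine i = u_2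
    cen-sp  : ∀ {i} → toℕ i ≡ 1 → TAdj center (spine i)
    cen-sl  : ∀ {a} → TAdj center (sleaf a)
    sl-cen  : ∀ {a} → TAdj (sleaf a) center

  TVerts : List TV
  TVerts = map spine (allFin s)
        ++ concatMap (λ i → map (leaf i) (allFin (code (suc (toℕ i))))) (allFin s)
        ++ [ center ]
        ++ map sleaf (allFin c)

  Tgraph : Graph
  Tgraph = record { V = TV ; verts = TVerts ; _~_ = TAdj }

{-# OPTIONS --safe #-}
module Submission where

-- Every vertex x hangs at height `height x` below a spine vertex `foot x`, and walking through the
-- spine gives d x y ≤ height x + |pos x - pos y| + height y. Lower bounds come from 1-Lipschitz
-- potentials f (changing by at most one along each edge), which satisfy f x ≤ d x y + f y; the
-- distance to the set of leaves at a spine vertex u_t is such a potential, and it makes the walk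
-- bound exact whenever y is a leaf. Hence the diameter is s + 1 and the peripheral vertices are
-- exactly the leaves at u₁, the leaves at u_s and the star leaves; the distances between them are
-- 2 inside each of these blocks, 4 between leaves at u₁ and star leaves, and s + 1 otherwise, and
-- summing d + d² over the six blocks of pairs gives the formula.

open import Defs
open import Data.Bool using (Bool; false; if_then_else_)
open import Data.Empty using (⊥-elim)
open import Data.Fin using (Fin; toℕ; fromℕ; fromℕ<; inject₁) renaming (zero to fzero; suc to fsuc)
open import Data.Fin.Properties using (toℕ-fromℕ; toℕ-fromℕ<; toℕ<n; toℕ-injective; inject₁ℕ<) renaming (_≟_ to _≟ᶠ_)
open import Data.List using (List; []; _∷_; _++_; [_]; map; concat; concatMap; filter; tabulate; allFin; length; cartesianProduct)
open import Data.List.Membership.Propositional using (_∈_)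
open import Data.List.Membership.Propositional.Properties using (∈-map⁺; ∈-allFin; ∈-++⁺ˡ; ∈-++⁺ʳ; ∈-concat⁺′)
open import Data.List.Properties using (filter-++; filter-all; filter-none; ++-identityʳ; map-++; map-tabulate; length-map; length-tabulate; cartesianProductWith-distribʳ-++)
open import Data.List.Relation.Unary.All as All using (All; []; _∷_)
import Data.List.Relation.Unary.All.Properties as All
open import Data.List.Relation.Unary.AllPairs as AllPairs using (AllPairs; []; _∷_)
import Data.List.Relation.Unary.AllPairs.Properties as AllPairs
open import Data.List.Relation.Unary.Any using (here; there)
open import Data.List.Relation.Unary.Unique.Propositional.Properties using (allFin⁺)
open import Data.Nat using (ℕ; zero; suc; _+_; _*_; _∸_; _≤_; _<_; z≤n; s≤s; s≤s⁻¹; ∣_-_∣)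
open import Data.Nat.Combinatorics using (_C_; nCk+nC[k+1]≡[n+1]C[k+1]; nC1≡n)
open import Data.Nat.Divisibility using (divides)
open import Data.Nat.DivMod using (_/_; m*n/n≡m; +-distrib-/-∣ˡ)
open import Data.Nat.ListAction using (sum)
open import Data.Nat.ListAction.Properties using (sum-++)
open import Data.Nat.Properties
open import Data.Nat.Tactic.RingSolver using (solve-∀)
open import Data.Product using (_×_; _,_; proj₁; proj₂)
open import Data.Sum using (inj₁; inj₂)
open import Function using (_∘_)
open import Relation.Binary.Definitions using (Symmetric)
open import Relation.Binary.PropositionalEquality using (_≡_; _≢_; refl; sym; trans; cong; cong₂; subst; module ≡-Reasoning)
open import Relation.Nullary using (¬_; Dec; does; yes; no)
open import Relation.Unary using (Pred; Decidable)

module _ {G : Graph} where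

  infixr 5 _++ʷ_
  _++ʷ_ : ∀ {x y z m n} → Walk G x y m → Walk G y z n → Walk G x z (m + n)
  nil      ++ʷ w′ = w′
  step e w ++ʷ w′ = step e (w ++ʷ w′)

  reverseʷ : Symmetric (_~_ G) → ∀ {x y m} → Walk G x y m → Walk G y x m
  reverseʷ sym nil                = nil
  reverseʷ sym (step {k = m} e w) = subst (Walk G _ _) (+-comm m 1) (reverseʷ sym w ++ʷ step (sym e) nil)

  length≥2 : ∀ {x y m} → x ≢ y → ¬ _~_ G x y → Walk G x y m → 2 ≤ m
  length≥2 x≢x _    nil                 = ⊥-elim (x≢x refl)
  length≥2 _   ¬x~y (step x~y nil)      = ⊥-elim (¬x~y x~y)
  length≥2 _   _    (step _ (step _ _)) = s≤s (s≤s z≤n)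

Lipschitz : (G : Graph) → (V G → ℕ) → Set
Lipschitz G f = ∀ {x y} → _~_ G x y → f x ≤ suc (f y)

lipschitz-walk : ∀ {G f} → Lipschitz G f → ∀ {x y m} → Walk G x y m → f x ≤ m + f y
lipschitz-walk L nil        = ≤-refl
lipschitz-walk L (step e w) = ≤-trans (L e) (s≤s (lipschitz-walk L w))

module _ {G : Graph} {d : V G → V G → ℕ} (isD : IsDistance G d) where

  d≤length : ∀ {x y m} → Walk G x y m → d x y ≤ m
  d≤length w = proj₂ (isD _ _) _ w

  lipschitz≤d : ∀ {f} → Lipschitz G f → ∀ x y → f x ≤ d x y + f y
  lipschitz≤d L x y = lipschitz-walk L (proj₁ (isD x y))

  d-sym : Symmetric (_~_ G) → ∀ x y → d x y ≡ d y x
  d-sym sym x y = ≤-antisym (d≤length (reverseʷ sym (proj₁ (isD y x))))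
                            (d≤length (reverseʷ sym (proj₁ (isD x y))))

  2≤d : ∀ {x y} → x ≢ y → ¬ _~_ G x y → 2 ≤ d x y
  2≤d x≢y ¬x~y = length≥2 x≢y ¬x~y (proj₁ (isD _ _))

maxList-≥ : ∀ {n ns} → n ∈ ns → n ≤ maxList ns
maxList-≥ {ns = m ∷ _} (here refl) = m≤m⊔n m _
maxList-≥ {ns = m ∷ _} (there n∈ns) = ≤-trans (maxList-≥ n∈ns) (m≤n⊔m m _)

maxList-≤ : ∀ {b ns} → All (_≤ b) ns → maxList ns ≤ b
maxList-≤ []           = z≤n
maxList-≤ (m≤b ∷ ns≤b) = ⊔-lub m≤b (maxList-≤ ns≤b)

module _ {a p} {A B : Set a} {P : Pred B p} (P? : Decidable P) where

  filter-concatMap : ∀ (f : A → List B) xs → filter P? (concatMap f xs) ≡ concatMap (filter P? ∘ f) xs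
  filter-concatMap f []       = refl
  filter-concatMap f (x ∷ xs) = trans (filter-++ P? (f x) (concatMap f xs))
                                      (cong (filter P? (f x) ++_) (filter-concatMap f xs))

concat-tabulate-last : ∀ {a} {A : Set a} {n} (f : Fin (suc n) → List A) →
                       (∀ i → f (inject₁ i) ≡ []) → concat (tabulate f) ≡ f (fromℕ n)
concat-tabulate-last {n = zero}  f _     = ++-identityʳ (f fzero)
concat-tabulate-last {n = suc n} f empty =
  trans (cong (_++ concat (tabulate (f ∘ fsuc))) (empty fzero))
        (concat-tabulate-last (f ∘ fsuc) (empty ∘ fsuc))

concatMap-allFin-ends : ∀ {a} {A : Set a} {n} (f : Fin (suc (suc n)) → List A) →
                        (∀ i → f (fsuc (inject₁ i)) ≡ []) →
                        concatMap f (allFin (suc (suc n))) ≡ f fzero ++ f (fromℕ (suc n))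
concatMap-allFin-ends {n = n} f inner-empty =
  cong (f fzero ++_) (trans (cong concat (map-tabulate fsuc f))
                            (concat-tabulate-last (f ∘ fsuc) inner-empty))

all-map-allFin : ∀ {a p} {A : Set a} {P : Pred A p} {n} (f : Fin n → A) →
                 (∀ i → P (f i)) → All P (map f (allFin n))
all-map-allFin {n = n} f Pf = All.map⁺ (All.universal Pf (allFin n))

length-map-allFin : ∀ {a} {A : Set a} {n} (f : Fin n → A) → length (map f (allFin n)) ≡ n
length-map-allFin {n = n} f = trans (length-map f (allFin n)) (length-tabulate {n = n} (λ i → i))

module PairSums {A : Set} (w : A × A → ℕ) where

  pairSum : List A → ℕ
  pairSum xs = sum (map w (pairs xs))

  crossSum : List A → List A → ℕ
  crossSum xs ys = sum (map w (cartesianProduct xs ys))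

  private
    rowSum : A → List A → ℕ
    rowSum x ys = sum (map w (map (x ,_) ys))

    sum-map-++ : ∀ ps qs → sum (map w (ps ++ qs)) ≡ sum (map w ps) + sum (map w qs)
    sum-map-++ ps qs = trans (cong sum (map-++ w ps qs)) (sum-++ (map w ps) (map w qs))

    rowSum-++ : ∀ x ys zs → rowSum x (ys ++ zs) ≡ rowSum x ys + rowSum x zs
    rowSum-++ x ys zs = trans (cong (sum ∘ map w) (map-++ (x ,_) ys zs))
                              (sum-map-++ (map (x ,_) ys) (map (x ,_) zs))

    rowSum-const : ∀ {K x ys} → All (λ y → w (x , y) ≡ K) ys → rowSum x ys ≡ length ys * K
    rowSum-const []         = refl
    rowSum-const (wK ∷ wKs) = cong₂ _+_ wK (rowSum-const wKs)

  pairSum-++ : ∀ xs ys → pairSum (xs ++ ys) ≡ pairSum xs + crossSum xs ys + pairSum ys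
  pairSum-++ []       ys = refl
  pairSum-++ (x ∷ xs) ys = begin
    pairSum (x ∷ xs ++ ys)
      ≡⟨ sum-map-++ (map (x ,_) (xs ++ ys)) (pairs (xs ++ ys)) ⟩
    rowSum x (xs ++ ys) + pairSum (xs ++ ys)
      ≡⟨ cong₂ _+_ (rowSum-++ x xs ys) (pairSum-++ xs ys) ⟩
    (rowSum x xs + rowSum x ys) + (pairSum xs + crossSum xs ys + pairSum ys)
      ≡⟨ regroup (rowSum x xs) (rowSum x ys) (pairSum xs) (crossSum xs ys) (pairSum ys) ⟩
    (rowSum x xs + pairSum xs) + (rowSum x ys + crossSum xs ys) + pairSum ys
      ≡⟨ cong₂ (λ p q → p + q + pairSum ys) (sym (sum-map-++ (map (x ,_) xs) (pairs xs)))
                                            (sym (sum-map-++ (map (x ,_) ys) _)) ⟩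
    pairSum (x ∷ xs) + crossSum (x ∷ xs) ys + pairSum ys ∎
    where
    open ≡-Reasoning
    regroup : ∀ a b p q r → (a + b) + (p + q + r) ≡ (a + p) + (b + q) + r
    regroup = solve-∀

  crossSum-++ˡ : ∀ xs ys zs → crossSum (xs ++ ys) zs ≡ crossSum xs zs + crossSum ys zs
  crossSum-++ˡ xs ys zs = trans (cong (sum ∘ map w) (cartesianProductWith-distribʳ-++ _,_ xs ys zs))
                                (sum-map-++ (cartesianProduct xs zs) (cartesianProduct ys zs))

  pairSum-const : ∀ {K xs} → AllPairs (λ x y → w (x , y) ≡ K) xs → pairSum xs ≡ (length xs C 2) * K
  pairSum-const []                       = refl
  pairSum-const {K} {x ∷ xs} (wKs ∷ wKss) = begin
    pairSum (x ∷ xs)                         ≡⟨ sum-map-++ (map (x ,_) xs) (pairs xs) ⟩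
    rowSum x xs + pairSum xs                 ≡⟨ cong₂ _+_ (rowSum-const wKs) (pairSum-const wKss) ⟩
    length xs * K + (length xs C 2) * K      ≡⟨ *-distribʳ-+ K (length xs) _ ⟨
    (length xs + (length xs C 2)) * K        ≡⟨ cong (λ n → (n + (length xs C 2)) * K) (nC1≡n (length xs)) ⟨
    ((length xs C 1) + (length xs C 2)) * K  ≡⟨ cong (_* K) (nCk+nC[k+1]≡[n+1]C[k+1] (length xs) 1) ⟩
    (suc (length xs) C 2) * K                ∎
    where open ≡-Reasoning

  crossSum-const : ∀ {K xs ys} → All (λ x → All (λ y → w (x , y) ≡ K) ys) xs →
                   crossSum xs ys ≡ length xs * length ys * K
  crossSum-const                    []           = refl
  crossSum-const {K} {x ∷ xs} {ys} (wKs ∷ wKss) = begin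
    crossSum (x ∷ xs) ys                          ≡⟨ sum-map-++ (map (x ,_) ys) (cartesianProduct xs ys) ⟩
    rowSum x ys + crossSum xs ys                  ≡⟨ cong₂ _+_ (rowSum-const wKs) (crossSum-const wKss) ⟩
    length ys * K + length xs * length ys * K     ≡⟨ *-distribʳ-+ K (length ys) _ ⟨
    (length ys + length xs * length ys) * K       ∎
    where open ≡-Reasoning

  pairSum-allFin : ∀ {n K} (f : Fin n → A) → (∀ {i j} → i ≢ j → w (f i , f j) ≡ K) →
                   pairSum (map f (allFin n)) ≡ (n C 2) * K
  pairSum-allFin {n} {K} f wK =
    trans (pairSum-const (AllPairs.map⁺ (AllPairs.map wK (allFin⁺ n))))
          (cong (λ m → (m C 2) * K) (length-map-allFin f))

  crossSum-allFin : ∀ {m n K} (f : Fin m → A) (g : Fin n → A) → (∀ i j → w (f i , g j) ≡ K) →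
                    crossSum (map f (allFin m)) (map g (allFin n)) ≡ m * n * K
  crossSum-allFin {K = K} f g wK =
    trans (crossSum-const (all-map-allFin f (λ i → all-map-allFin g (wK i))))
          (cong₂ (λ m n → m * n * K) (length-map-allFin f) (length-map-allFin g))

∣n-1+n∣≡1 : ∀ n → ∣ n - suc n ∣ ≡ 1
∣n-1+n∣≡1 zero    = refl
∣n-1+n∣≡1 (suc n) = ∣n-1+n∣≡1 n

∣-∣-neighbour : ∀ m n t → ∣ m - n ∣ ≡ 1 → ∣ m - t ∣ ≤ suc ∣ n - t ∣
∣-∣-neighbour m n t m~n = subst (λ z → ∣ m - t ∣ ≤ z + ∣ n - t ∣) m~n (∣-∣-triangle m n t)

spread≤ : ∀ {e n hx px hy py} → hx ≤ suc px → suc (hx + px) ≤ suc n →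
          hy ≤ e + py → suc (hy + py) ≤ e + n → hy + (hx + ∣ px - py ∣) ≤ e + n
spread≤ {e} {n} {hx} {px} {hy} {py} hx≤ hx+px< hy≤ hy+py< with ≤-total px py
... | inj₁ px≤py = begin
  hy + (hx + ∣ px - py ∣)   ≡⟨ cong (λ z → hy + (hx + z)) (m≤n⇒∣m-n∣≡n∸m px≤py) ⟩
  hy + (hx + (py ∸ px))     ≤⟨ +-monoʳ-≤ hy (+-monoˡ-≤ (py ∸ px) hx≤) ⟩
  hy + suc (px + (py ∸ px)) ≡⟨ cong (λ z → hy + suc z) (m+[n∸m]≡n px≤py) ⟩
  hy + suc py               ≡⟨ +-suc hy py ⟩
  suc (hy + py)             ≤⟨ hy+py< ⟩
  e + n                     ∎
  where open ≤-Reasoning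
... | inj₂ py≤px = begin
  hy + (hx + ∣ px - py ∣)     ≡⟨ cong (λ z → hy + (hx + z)) (m≤n⇒∣n-m∣≡n∸m py≤px) ⟩
  hy + (hx + (px ∸ py))       ≤⟨ +-monoˡ-≤ (hx + (px ∸ py)) hy≤ ⟩
  (e + py) + (hx + (px ∸ py)) ≡⟨ regroup e py hx (px ∸ py) ⟩
  e + (hx + (py + (px ∸ py))) ≡⟨ cong (λ z → e + (hx + z)) (m+[n∸m]≡n py≤px) ⟩
  e + (hx + px)               ≤⟨ +-monoʳ-≤ e (s≤s⁻¹ hx+px<) ⟩
  e + n                       ∎
  where
  open ≤-Reasoning
  regroup : ∀ a b p q → (a + b) + (p + q) ≡ a + (p + (b + q))
  regroup = solve-∀

weight : ℕ → ℕ
weight n = n + n * n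

-- Twice PWW(T), summed over the six blocks of peripheral pairs; D is the diameter.
doublePWW : (c₁ cₛ c D : ℕ) → ℕ
doublePWW c₁ cₛ c D = (c₁ C 2) * weight 2 + c₁ * cₛ * weight D + (cₛ C 2) * weight 2
                    + (c₁ * c * weight 4 + cₛ * c * weight D) + (c C 2) * weight 2

doublePWW/2 : ∀ c₁ cₛ c s → doublePWW c₁ cₛ c (suc s) / 2
              ≡ 3 * (c₁ C 2) + 3 * (cₛ C 2) + 3 * (c C 2) + 10 * c₁ * c + (cₛ * (c₁ + c) * ((s + 1) * (s + 2))) / 2
doublePWW/2 c₁ cₛ c s = begin
  doublePWW c₁ cₛ c (suc s) / 2 ≡⟨ cong (_/ 2) (regroup (c₁ C 2) (cₛ C 2) (c C 2) c₁ cₛ c s) ⟩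
  (X * 2 + Y) / 2               ≡⟨ +-distrib-/-∣ˡ Y (divides X refl) ⟩
  X * 2 / 2 + Y / 2             ≡⟨ cong (_+ Y / 2) (m*n/n≡m X 2) ⟩
  X + Y / 2                     ∎
  where
  open ≡-Reasoning
  X Y : ℕ
  X = 3 * (c₁ C 2) + 3 * (cₛ C 2) + 3 * (c C 2) + 10 * c₁ * c
  Y = cₛ * (c₁ + c) * ((s + 1) * (s + 2))
  regroup : ∀ a₁ aₛ a c₁ cₛ c s →
            a₁ * 6 + c₁ * cₛ * (suc s + suc s * suc s) + aₛ * 6
              + (c₁ * c * 20 + cₛ * c * (suc s + suc s * suc s)) + a * 6
            ≡ (3 * a₁ + 3 * aₛ + 3 * a + 10 * c₁ * c) * 2 + cₛ * (c₁ + c) * ((s + 1) * (s + 2))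
  regroup = solve-∀

module CaterpillarWithStar (k : ℕ) (code : ℕ → ℕ) (c : ℕ) where

  s : ℕ
  s = suc (suc (suc k))

  T : Graph
  T = Tgraph s code c

  TAdj-sym : Symmetric (TAdj s code c)
  TAdj-sym (sp-next eq) = sp-prev eq
  TAdj-sym (sp-prev eq) = sp-next eq
  TAdj-sym sp-leaf      = leaf-sp
  TAdj-sym leaf-sp      = sp-leaf
  TAdj-sym (sp-cen eq)  = cen-sp eq
  TAdj-sym (cen-sp eq)  = sp-cen eq
  TAdj-sym cen-sl       = sl-cen
  TAdj-sym sl-cen       = cen-sl

  last : Fin s
  last = fromℕ (suc (suc k))

  toℕ-last : toℕ last ≡ suc (suc k)
  toℕ-last = toℕ-fromℕ (suc (suc k))

  foot : TV s code c → Fin s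
  foot (spine i)  = i
  foot (leaf i _) = i
  foot center     = fsuc fzero
  foot (sleaf _)  = fsuc fzero

  height : TV s code c → ℕ
  height (spine _)  = 0
  height (leaf _ _) = 1
  height center     = 1
  height (sleaf _)  = 2

  pos : TV s code c → ℕ
  pos = toℕ ∘ foot

  offset : Fin s → TV s code c → ℕ
  offset t x = height x + ∣ pos x - toℕ t ∣

  route : TV s code c → TV s code c → ℕ
  route x y = height y + offset (foot y) x

  ascend : ∀ m {i j : Fin s} → toℕ i + m ≡ toℕ j → Walk T (spine i) (spine j) m
  ascend zero {i} eq with toℕ-injective (trans (sym (+-identityʳ (toℕ i))) eq)
  ... | refl = nil
  ascend (suc m) {i} {j} eq = step (sp-next (toℕ-fromℕ< i+1<s)) (ascend m i+1+m≡j)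
    where
    i+1<s : suc (toℕ i) < s
    i+1<s = ≤-<-trans (subst (suc (toℕ i) ≤_) eq (m<m+n (toℕ i) (s≤s z≤n))) (toℕ<n j)
    i+1+m≡j : toℕ (fromℕ< i+1<s) + m ≡ toℕ j
    i+1+m≡j = trans (cong (_+ m) (toℕ-fromℕ< i+1<s)) (trans (sym (+-suc (toℕ i) m)) eq)

  spineWalk : ∀ i j → Walk T (spine i) (spine j) ∣ toℕ i - toℕ j ∣
  spineWalk i j with ≤-total (toℕ i) (toℕ j)
  ... | inj₁ i≤j = subst (Walk T _ _) (sym (m≤n⇒∣m-n∣≡n∸m i≤j))
                         (ascend (toℕ j ∸ toℕ i) (m+[n∸m]≡n i≤j))
  ... | inj₂ j≤i = subst (Walk T _ _) (sym (m≤n⇒∣n-m∣≡n∸m j≤i))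
                         (reverseʷ TAdj-sym (ascend (toℕ i ∸ toℕ j) (m+[n∸m]≡n j≤i)))

  toFoot : ∀ x → Walk T x (spine (foot x)) (height x)
  toFoot (spine _)  = nil
  toFoot (leaf _ _) = step leaf-sp nil
  toFoot center     = step (cen-sp refl) nil
  toFoot (sleaf _)  = step sl-cen (step (cen-sp refl) nil)

  routeWalk : ∀ x y → Walk T x y (route x y)
  routeWalk x y = subst (Walk T x y) (+-comm (offset (foot y) x) (height y))
    ((toFoot x ++ʷ spineWalk (foot x) (foot y)) ++ʷ reverseʷ TAdj-sym (toFoot y))

  offset-lipschitz : ∀ t → Lipschitz T (offset t)
  offset-lipschitz t (sp-next {i} {j} eq) =
    ∣-∣-neighbour (toℕ i) (toℕ j) (toℕ t) (trans (cong (∣ toℕ i -_∣) eq) (∣n-1+n∣≡1 (toℕ i)))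
  offset-lipschitz t (sp-prev {i} {j} eq) =
    ∣-∣-neighbour (toℕ i) (toℕ j) (toℕ t)
      (trans (cong (∣_- toℕ j ∣) eq) (trans (∣-∣-comm (suc (toℕ j)) (toℕ j)) (∣n-1+n∣≡1 (toℕ j))))
  offset-lipschitz t sp-leaf                = m≤n+m _ 2
  offset-lipschitz t leaf-sp                = ≤-refl
  offset-lipschitz t (sp-cen eq) rewrite eq = m≤n+m _ 2
  offset-lipschitz t (cen-sp eq) rewrite eq = ≤-refl
  offset-lipschitz t cen-sl                 = s≤s (m≤n+m _ 2)
  offset-lipschitz t sl-cen                 = ≤-refl

  isLeafAt : Fin s → TV s code c → Bool
  isLeafAt t (leaf i _) = does (i ≟ᶠ t)
  isLeafAt t _          = false

  leafDist : Fin s → TV s code c → ℕ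
  leafDist t x = if isLeafAt t x then 0 else suc (offset t x)

  leafDist-self : ∀ t b → leafDist t (leaf t b) ≡ 0
  leafDist-self t b with t ≟ᶠ t
  ... | yes _   = refl
  ... | no t≢t = ⊥-elim (t≢t refl)

  leafDist-lipschitz : ∀ t → Lipschitz T (leafDist t)
  leafDist-lipschitz t (sp-leaf {i}) with i ≟ᶠ t
  ... | yes refl = ≤-reflexive (cong suc (∣n-n∣≡0 (toℕ t)))
  ... | no _     = s≤s (m≤n+m _ 2)
  leafDist-lipschitz t (leaf-sp {i}) with i ≟ᶠ t
  ... | yes _ = z≤n
  ... | no _  = ≤-refl
  leafDist-lipschitz t e@(sp-next _) = s≤s (offset-lipschitz t e)
  leafDist-lipschitz t e@(sp-prev _) = s≤s (offset-lipschitz t e)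
  leafDist-lipschitz t e@(sp-cen _)  = s≤s (offset-lipschitz t e)
  leafDist-lipschitz t e@(cen-sp _)  = s≤s (offset-lipschitz t e)
  leafDist-lipschitz t e@cen-sl      = s≤s (offset-lipschitz t e)
  leafDist-lipschitz t e@sl-cen      = s≤s (offset-lipschitz t e)

  -- NearEnds e x: x is within distance s - 1 + e of both ends u₁ and u_s of the spine.
  NearEnds : ℕ → TV s code c → Set
  NearEnds e x = height x ≤ e + pos x × suc (height x + pos x) ≤ e + s

  nearEnds₁ : ∀ x → NearEnds 1 x
  nearEnds₁ (spine i)  = z≤n , m≤n⇒m≤1+n (toℕ<n i)
  nearEnds₁ (leaf i _) = s≤s z≤n , s≤s (toℕ<n i)
  nearEnds₁ center     = s≤s z≤n , s≤s (s≤s (s≤s z≤n))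
  nearEnds₁ (sleaf _)  = ≤-refl , s≤s (s≤s (s≤s (s≤s z≤n)))

  route≤ : ∀ {e} x y → NearEnds 1 x → NearEnds e y → route x y ≤ e + s
  route≤ x y (hx≤ , hx+px<) (hy≤ , hy+py<) = spread≤ hx≤ hx+px< hy≤ hy+py<

  nearEnds₀-spine : ∀ i → NearEnds 0 (spine i)
  nearEnds₀-spine i = z≤n , toℕ<n i

  nearEnds₀-center : NearEnds 0 center
  nearEnds₀-center = ≤-refl , s≤s (s≤s (s≤s z≤n))

  nearEnds₀-inner : ∀ i a → NearEnds 0 (leaf (fsuc (inject₁ i)) a)
  nearEnds₀-inner i a = s≤s z≤n , s≤s (s≤s (inject₁ℕ< i))

  leavesAt : (i : Fin s) → List (TV s code c)
  leavesAt i = map (leaf i) (allFin (code (suc (toℕ i))))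

  starLeaves : List (TV s code c)
  starLeaves = map sleaf (allFin c)

  leaf∈TVerts : ∀ i a → leaf i a ∈ TVerts s code c
  leaf∈TVerts i a = ∈-++⁺ʳ (map spine (allFin s))
    (∈-++⁺ˡ (∈-concat⁺′ (∈-map⁺ (leaf i) (∈-allFin a)) (∈-map⁺ leavesAt (∈-allFin i))))

  code-last : code (suc (toℕ last)) ≡ code s
  code-last = cong (code ∘ suc) toℕ-last

  module Distances {d : TV s code c → TV s code c → ℕ} (isD : IsDistance T d) where

    ecc : TV s code c → ℕ
    ecc = eccentricity T d

    d≤route : ∀ x y → d x y ≤ route x y
    d≤route x y = d≤length isD (routeWalk x y)

    d-to-leaf : ∀ {t x} b → isLeafAt t x ≡ false → d x (leaf t b) ≡ suc (offset t x)
    d-to-leaf {t} {x} b x-not-at-t = ≤-antisym (d≤route x (leaf t b)) (begin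
      suc (offset t x)                 ≡⟨ cong (λ l → if l then 0 else suc (offset t x)) x-not-at-t ⟨
      leafDist t x                     ≤⟨ lipschitz≤d isD (leafDist-lipschitz t) x (leaf t b) ⟩
      d x (leaf t b) + leafDist t (leaf t b)
                                       ≡⟨ cong (d x (leaf t b) +_) (leafDist-self t b) ⟩
      d x (leaf t b) + 0               ≡⟨ +-identityʳ _ ⟩
      d x (leaf t b)                   ∎)
      where open ≤-Reasoning

    d-first-last : ∀ a b → d (leaf fzero a) (leaf last b) ≡ suc s
    d-first-last a b = trans (d-to-leaf b refl) (cong (suc ∘ suc) toℕ-last)

    d-last-first : ∀ a b → d (leaf last a) (leaf fzero b) ≡ suc s
    d-last-first a b = trans (d-to-leaf b refl) (cong (suc ∘ suc) toℕ-last)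

    d-star-first : ∀ a b → d (sleaf a) (leaf fzero b) ≡ 4
    d-star-first a b = d-to-leaf b refl

    d-star-last : ∀ a b → d (sleaf a) (leaf last b) ≡ suc s
    d-star-last a b = trans (d-to-leaf b refl) (cong (λ n → suc (2 + ∣ 1 - n ∣)) toℕ-last)

    d-sibling-leaves : ∀ {i a b} → a ≢ b → d (leaf i a) (leaf i b) ≡ 2
    d-sibling-leaves a≢b = ≤-antisym (d≤length isD (step leaf-sp (step sp-leaf nil)))
                                     (2≤d isD (λ { refl → a≢b refl }) λ ())

    d-star-leaves : ∀ {a b} → a ≢ b → d (sleaf a) (sleaf b) ≡ 2
    d-star-leaves a≢b = ≤-antisym (d≤length isD (step sl-cen (step cen-sl nil)))
                                  (2≤d isD (λ { refl → a≢b refl }) λ ())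

    ecc≤ : ∀ {e y} → NearEnds e y → ecc y ≤ e + s
    ecc≤ {y = y} y-near = maxList-≤ (All.map⁺ (All.universal
      (λ x → ≤-trans (d≤route x y) (route≤ x y (nearEnds₁ x) y-near)) (TVerts s code c)))

    d≤ecc : ∀ {x y} → x ∈ TVerts s code c → d x y ≤ ecc y
    d≤ecc {y = y} x∈T = maxList-≥ (∈-map⁺ (λ x → d x y) x∈T)

    ecc-attained : ∀ {x y} → x ∈ TVerts s code c → d x y ≡ suc s → ecc y ≡ suc s
    ecc-attained x∈T dxy = ≤-antisym (ecc≤ (nearEnds₁ _)) (subst (_≤ ecc _) dxy (d≤ecc x∈T))

    module Peripheral (a₁ : Fin (code 1)) (aₛ : Fin (code s)) where

      aₗ : Fin (code (suc (toℕ last)))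
      aₗ = subst Fin (sym code-last) aₛ

      ecc-first : ∀ a → ecc (leaf fzero a) ≡ suc s
      ecc-first a = ecc-attained (leaf∈TVerts last aₗ) (d-last-first aₗ a)

      ecc-last : ∀ a → ecc (leaf last a) ≡ suc s
      ecc-last a = ecc-attained (leaf∈TVerts fzero a₁) (d-first-last a₁ a)

      ecc-star : ∀ a → ecc (sleaf a) ≡ suc s
      ecc-star a = ecc-attained (leaf∈TVerts last aₗ)
                                (trans (d-sym isD TAdj-sym _ _) (d-star-last a aₗ))

      diameter≡ : diameter T d ≡ suc s
      diameter≡ = ≤-antisym
        (maxList-≤ (All.map⁺ (All.universal (λ v → ecc≤ (nearEnds₁ v)) (TVerts s code c))))
        (subst (_≤ diameter T d) (ecc-first a₁) (maxList-≥ (∈-map⁺ ecc (leaf∈TVerts fzero a₁))))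

      peripheral? : (v : TV s code c) → Dec (ecc v ≡ diameter T d)
      peripheral? v = ecc v ≟ diameter T d

      not-peripheral : ∀ {v} → NearEnds 0 v → ¬ ecc v ≡ diameter T d
      not-peripheral v-near eq = <⇒≢ (s≤s (ecc≤ v-near)) (trans eq diameter≡)

      all-peripheral : ∀ {n} (f : Fin n → TV s code c) → (∀ a → ecc (f a) ≡ suc s) →
                       All (λ v → ecc v ≡ diameter T d) (map f (allFin n))
      all-peripheral f ecc-f = all-map-allFin f (λ a → trans (ecc-f a) (sym diameter≡))

      Peri≡ : Peri T d ≡ (leavesAt fzero ++ leavesAt last) ++ starLeaves
      Peri≡ = begin
        filter peripheral? (spines ++ leaves ++ [ center ] ++ starLeaves)
          ≡⟨ filter-++ peripheral? spines _ ⟩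
        filter peripheral? spines ++ filter peripheral? (leaves ++ [ center ] ++ starLeaves)
          ≡⟨ cong (_++ filter peripheral? (leaves ++ [ center ] ++ starLeaves))
                  (filter-none peripheral? spines-np) ⟩
        filter peripheral? (leaves ++ [ center ] ++ starLeaves)
          ≡⟨ filter-++ peripheral? leaves _ ⟩
        filter peripheral? leaves ++ filter peripheral? ([ center ] ++ starLeaves)
          ≡⟨ cong₂ _++_ leaves-filter (filter-++ peripheral? [ center ] starLeaves) ⟩
        (leavesAt fzero ++ leavesAt last) ++ filter peripheral? [ center ] ++ filter peripheral? starLeaves
          ≡⟨ cong₂ (λ l l′ → (leavesAt fzero ++ leavesAt last) ++ l ++ l′)
                   (filter-none peripheral? (not-peripheral nearEnds₀-center ∷ []))
                   (filter-all peripheral? (all-peripheral sleaf ecc-star)) ⟩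
        (leavesAt fzero ++ leavesAt last) ++ starLeaves ∎
        where
        open ≡-Reasoning
        spines leaves : List (TV s code c)
        spines = map spine (allFin s)
        leaves = concatMap leavesAt (allFin s)
        spines-np : All (λ v → ¬ ecc v ≡ diameter T d) spines
        spines-np = all-map-allFin spine (not-peripheral ∘ nearEnds₀-spine)
        leaves-filter : filter peripheral? leaves ≡ leavesAt fzero ++ leavesAt last
        leaves-filter = begin
          filter peripheral? leaves
            ≡⟨ filter-concatMap peripheral? leavesAt (allFin s) ⟩
          concatMap (filter peripheral? ∘ leavesAt) (allFin s)
            ≡⟨ concatMap-allFin-ends (filter peripheral? ∘ leavesAt) (λ i → filter-none peripheral?
                 (all-map-allFin (leaf (fsuc (inject₁ i))) (not-peripheral ∘ nearEnds₀-inner i))) ⟩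
          filter peripheral? (leavesAt fzero) ++ filter peripheral? (leavesAt last)
            ≡⟨ cong₂ _++_ (filter-all peripheral? (all-peripheral (leaf fzero) ecc-first))
                          (filter-all peripheral? (all-peripheral (leaf last) ecc-last)) ⟩
          leavesAt fzero ++ leavesAt last ∎

      open PairSums (λ p → weight (d (proj₁ p) (proj₂ p)))

      PWW≡ : PWW T d ≡ doublePWW (code 1) (code s) c (suc s) / 2
      PWW≡ = cong (_/ 2) (begin
        pairSum (Peri T d)
          ≡⟨ cong pairSum Peri≡ ⟩
        pairSum ((firsts ++ lasts) ++ starLeaves)
          ≡⟨ pairSum-++ (firsts ++ lasts) starLeaves ⟩
        pairSum (firsts ++ lasts) + crossSum (firsts ++ lasts) starLeaves + pairSum starLeaves
          ≡⟨ cong₂ (λ p q → p + q + pairSum starLeaves)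
                   (pairSum-++ firsts lasts) (crossSum-++ˡ firsts lasts starLeaves) ⟩
        pairSum firsts + crossSum firsts lasts + pairSum lasts
          + (crossSum firsts starLeaves + crossSum lasts starLeaves) + pairSum starLeaves
          ≡⟨ cong₂ _+_ (cong₂ _+_ (cong₂ _+_ (cong₂ _+_ firsts-pairs firsts×lasts) lasts-pairs)
                                  (cong₂ _+_ firsts×stars lasts×stars))
                       stars-pairs ⟩
        doublePWW (code 1) (code (suc (toℕ last))) c (suc s)
          ≡⟨ cong (λ n → doublePWW (code 1) n c (suc s)) code-last ⟩
        doublePWW (code 1) (code s) c (suc s) ∎)
        where
        open ≡-Reasoning
        firsts lasts : List (TV s code c)
        firsts = leavesAt fzero
        lasts  = leavesAt last
        firsts-pairs : pairSum firsts ≡ (code 1 C 2) * weight 2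
        firsts-pairs = pairSum-allFin (leaf fzero) (λ a≢b → cong weight (d-sibling-leaves a≢b))
        lasts-pairs : pairSum lasts ≡ (code (suc (toℕ last)) C 2) * weight 2
        lasts-pairs  = pairSum-allFin (leaf last) (λ a≢b → cong weight (d-sibling-leaves a≢b))
        stars-pairs : pairSum starLeaves ≡ (c C 2) * weight 2
        stars-pairs  = pairSum-allFin sleaf (λ a≢b → cong weight (d-star-leaves a≢b))
        firsts×lasts : crossSum firsts lasts ≡ code 1 * code (suc (toℕ last)) * weight (suc s)
        firsts×lasts = crossSum-allFin (leaf fzero) (leaf last) (λ a b → cong weight (d-first-last a b))
        firsts×stars : crossSum firsts starLeaves ≡ code 1 * c * weight 4
        firsts×stars = crossSum-allFin (leaf fzero) sleaf
          (λ a b → cong weight (trans (d-sym isD TAdj-sym _ _) (d-star-first b a)))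
        lasts×stars : crossSum lasts starLeaves ≡ code (suc (toℕ last)) * c * weight (suc s)
        lasts×stars  = crossSum-allFin (leaf last) sleaf
          (λ a b → cong weight (trans (d-sym isD TAdj-sym _ _) (d-star-last b a)))

mainTheorem14 : (s : ℕ) (code : ℕ → ℕ) (c : ℕ) →
    3 ≤ s → code 1 ≢ 0 → code 2 ≡ 0 → code s ≢ 0 → 1 ≤ c →
    (d : TV s code c → TV s code c → ℕ) → IsDistance (Tgraph s code c) d →
    PWW (Tgraph s code c) d
      ≡ 3 * (code 1 C 2) + 3 * (code s C 2) + 3 * (c C 2) + 10 * code 1 * c
        + (code s * (code 1 + c) * ((s + 1) * (s + 2))) / 2
mainTheorem14 s@(suc (suc (suc k))) code c (s≤s (s≤s (s≤s z≤n))) c₁≢0 _ cₛ≢0 _ d isD =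
  trans (PWW≡ (fromℕ< (n≢0⇒n>0 c₁≢0)) (fromℕ< (n≢0⇒n>0 cₛ≢0))) (doublePWW/2 (code 1) (code s) c s)
  where open CaterpillarWithStar k code c hiding (s)
        open Distances isD
        open Peripheral
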